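{- In the binary tree instance described in the context, map each node $v$ of the tree to the point $d(\rho,v)$ on the real line. Then for every internal node $u$, every node of the subtree rooted at the left child of $u$ is mapped to a point strictly greater than the point of every node of the subtree rooted at the right child of $u$.
   Context: Let $L\ge 2$ be an integer and $B:=2^{2^{L+1}}$. Let $\mathcal{T}$ be a complete binary tree with root $\rho$ in which every root-to-leaf path has $L$ nodes; each internal node has a left and a right child. The level $\ell(v)$ of a node is the number of nodes on the path from $v$ to a leaf (leaves have level 1, the root level $L$). Sizes: $s_\rho:=2^{2^L}$, and for a node $v$ with parent $u$, $s_v:=s_u\cdot 2^{2^{\ell(v)}}$ if $v$ is the right child and $s_v:=s_u\cdot 2^{ -2^{\ell(v)}}$ if $v$ is the left child. Residual budgets: $b(\rho):=B$, and $b(v):=b(u)-s_u$ if $v$ is the right child of $u$, $b(v):=s_u$ if $v$ is the left child. Edge lengths: the edge from $u$ to its right child has length $0$, and the edge from $u$ to its left child has length $b(u)-s_u$. $d(\rho,v)$ denotes the sum of edge lengths on the tree path from $\rho$ to $v$. -}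

module Defs where

open import Data.Bool using (Bool; true; false)
open import Data.List using (List; []; _∷_)
open import Data.Nat using (ℕ; zero; suc; _∸_) renaming (_^_ to _^ℕ_)
open import Data.Integer using (+_)
open import Data.Rational using (ℚ; _/_; _+_; _*_; _-_; 1ℚ; 0ℚ; ½)
open import Data.Product using (_×_; _,_; proj₁; proj₂)

pow2 : ℕ → ℚ
pow2 n = (+ (2 ^ℕ n)) / 1

invPow2 : ℕ → ℚ
invPow2 zero = 1ℚ
invPow2 (suc n) = ½ * invPow2 n

-- A node of T is given by its path from the root ρ: a list of directions
-- (true = go to right child, false = go to left child).  With L levels,
-- the valid nodes are the lists of length < L; a node at depth k has
-- level L ∸ k.

record NodeData : Set where
  constructor nd
  field
    size   : ℚ
    budget : ℚ
    dist   : ℚ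
open NodeData public

walk : ℕ → NodeData → List Bool → NodeData
walk ℓ x [] = x
walk ℓ (nd s b d) (true ∷ p) =
  -- right child: s_v = s_u·2^{2^{ℓ(v)}}, b(v) = b(u) − s_u, edge length 0
  walk (ℓ ∸ 1) (nd (s * pow2 (2 ^ℕ (ℓ ∸ 1))) (b - s) d) p
walk ℓ (nd s b d) (false ∷ p) =
  -- left child: s_v = s_u·2^{-2^{ℓ(v)}}, b(v) = s_u, edge length b(u) − s_u
  walk (ℓ ∸ 1) (nd (s * invPow2 (2 ^ℕ (ℓ ∸ 1))) s (d + (b - s))) p

rootData : ℕ → NodeData
rootData L = nd (pow2 (2 ^ℕ L)) (pow2 (2 ^ℕ (suc L))) 0ℚ

dρ : ℕ → List Bool → ℚ
dρ L p = dist (walk L (rootData L) p)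

module Submission where

-- Call a node of level ℓ *feasible* when 0 < s and
-- s·(2^{2^ℓ} − 1) ≤ b.  The root is feasible, and feasibility passes to both
-- children; for the right child this uses 2^{2^{ℓ+1}} = (2^{2^ℓ})², for the left
-- child that 2^{-2^ℓ}·2^{2^ℓ} = 1.  On a feasible node s ≤ b, so along any
-- downward path the distance d never decreases, the potential d + b never
-- increases, and the budget stays positive.
--
-- Now let u have data (s, b, d).  The potential of its right child is
-- d + (b − s), which is exactly the distance of its left child.  So a node x of
-- the right subtree has d(x) < d(x) + b(x) ≤ d + (b − s), while every node y of
-- the left subtree has d + (b − s) ≤ d(y).

open import Defs
open import Data.Bool using (Bool; true; false)
open import Data.List using (List; []; _∷_; _++_; length)
open import Data.Nat as ℕ using (ℕ; suc; s≤s; _∸_) renaming (_^_ to _^ℕ_)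
import Data.Nat.Properties as ℕ
open import Data.Nat.Coprimality using (1-coprimeTo) renaming (sym to coprime-sym)
open import Data.Integer as ℤ using (+_)
import Data.Integer.Properties as ℤ
open import Data.Rational
  using (ℚ; mkℚ; _/_; _+_; _*_; _-_; -_; 1ℚ; 0ℚ; ½; _≤_; _<_; *≤*; *<*; positive; nonNegative)
  renaming (_>_ to _>ℚ_)
open import Data.Rational.Properties
open import Data.Rational.Solver using (module +-*-Solver)
open import Data.Product using (_×_; _,_; proj₂)
open import Relation.Binary.Definitions using (Reflexive; Transitive)
open import Relation.Binary.PropositionalEquality
  using (_≡_; refl; sym; trans; cong; cong₂; subst; subst₂; module ≡-Reasoning)

toℚ : ℕ → ℚ
toℚ n = + n / 1

n/1 : ℕ → ℚ
n/1 n = mkℚ (+ n) 0 (coprime-sym (1-coprimeTo n))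

toℚ-mkℚ : ∀ n → toℚ n ≡ n/1 n
toℚ-mkℚ n = ↥p/↧p≡p (n/1 n)

toℚ-* : ∀ a b → toℚ (a ℕ.* b) ≡ toℚ a * toℚ b
toℚ-* a b = begin
  toℚ (a ℕ.* b)                  ≡⟨ cong (_/ 1) (ℤ.pos-* a b) ⟩
  (+ a ℤ.* + b) / 1              ≡⟨⟩
  n/1 a * n/1 b                  ≡⟨ sym (cong₂ _*_ (toℚ-mkℚ a) (toℚ-mkℚ b)) ⟩
  toℚ a * toℚ b                  ∎
  where open ≡-Reasoning

toℚ-mono : ∀ {a b} → a ℕ.≤ b → toℚ a ≤ toℚ b
toℚ-mono {a} {b} a≤b rewrite toℚ-mkℚ a | toℚ-mkℚ b =
  *≤* (subst₂ ℤ._≤_ (sym (ℤ.*-identityʳ (+ a))) (sym (ℤ.*-identityʳ (+ b))) (ℤ.+≤+ a≤b))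

pow2-+ : ∀ a b → pow2 (a ℕ.+ b) ≡ pow2 a * pow2 b
pow2-+ a b = trans (cong toℚ (ℕ.^-distribˡ-+-* 2 a b)) (toℚ-* (2 ^ℕ a) (2 ^ℕ b))

pow2-square : ∀ m → pow2 (2 ^ℕ suc m) ≡ pow2 (2 ^ℕ m) * pow2 (2 ^ℕ m)
pow2-square m =
  trans (cong (λ k → pow2 (2 ^ℕ m ℕ.+ k)) (ℕ.+-identityʳ (2 ^ℕ m))) (pow2-+ (2 ^ℕ m) (2 ^ℕ m))

invPow2-pow2 : ∀ k → invPow2 k * pow2 k ≡ 1ℚ
invPow2-pow2 ℕ.zero = refl
invPow2-pow2 (suc k) = begin
  (½ * invPow2 k) * pow2 (suc k)          ≡⟨ cong ((½ * invPow2 k) *_) (pow2-+ 1 k) ⟩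
  (½ * invPow2 k) * (pow2 1 * pow2 k)     ≡⟨ solve 4 (λ a i t p → (a :* i) :* (t :* p) := (a :* t) :* (i :* p))
                                                refl ½ (invPow2 k) (pow2 1) (pow2 k) ⟩
  (½ * pow2 1) * (invPow2 k * pow2 k)     ≡⟨ cong ((½ * pow2 1) *_) (invPow2-pow2 k) ⟩
  1ℚ                                      ∎
  where open ≡-Reasoning
        open +-*-Solver

invPow2-pos : ∀ k → 0ℚ < invPow2 k
invPow2-pos ℕ.zero = *<* (ℤ.+<+ (s≤s ℕ.z≤n))
invPow2-pos (suc k) = subst (_< ½ * invPow2 k) (*-zeroʳ ½) (*-monoʳ-<-pos ½ (invPow2-pos k))

two≤pow2 : ∀ m → toℚ 2 ≤ pow2 (2 ^ℕ m)
two≤pow2 m = toℚ-mono (ℕ.^-monoʳ-≤ 2 (ℕ.m^n>0 2 m))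

pow2-pos : ∀ m → 0ℚ < pow2 (2 ^ℕ m)
pow2-pos m = <-≤-trans (*<* (ℤ.+<+ (s≤s ℕ.z≤n))) (two≤pow2 m)

x≤x+y : ∀ {x y} → 0ℚ ≤ y → x ≤ x + y
x≤x+y {x} 0≤y = subst (_≤ x + _) (+-identityʳ x) (+-monoʳ-≤ x 0≤y)

x<x+y : ∀ {x y} → 0ℚ < y → x < x + y
x<x+y {x} 0<y = subst (_< x + _) (+-identityʳ x) (+-monoʳ-< x 0<y)

0≤y-x : ∀ {x y} → x ≤ y → 0ℚ ≤ y - x
0≤y-x {x} {y} x≤y = subst (_≤ y - x) (+-inverseʳ x) (+-monoˡ-≤ (- x) x≤y)

*-monoˡ-≤-0≤ : ∀ {s x y} → 0ℚ ≤ s → x ≤ y → s * x ≤ s * y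
*-monoˡ-≤-0≤ {s} 0≤s = *-monoˡ-≤-nonNeg s {{nonNegative 0≤s}}

0≤* : ∀ {s q} → 0ℚ ≤ s → 0ℚ ≤ q → 0ℚ ≤ s * q
0≤* {s} 0≤s 0≤q = subst (_≤ s * _) (*-zeroʳ s) (*-monoˡ-≤-0≤ 0≤s 0≤q)

0<* : ∀ {s q} → 0ℚ < s → 0ℚ < q → 0ℚ < s * q
0<* {s} {q} 0<s 0<q = subst (_< s * q) (*-zeroˡ q) (*-monoˡ-<-pos q {{positive 0<q}} 0<s)

child : ℕ → Bool → NodeData → NodeData
child m true  (nd s b d) = nd (s * pow2 (2 ^ℕ m)) (b - s) d
child m false (nd s b d) = nd (s * invPow2 (2 ^ℕ m)) s (d + (b - s))

walk-cons : ∀ m c x p → walk (suc m) x (c ∷ p) ≡ walk m (child m c x) p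
walk-cons m true  (nd s b d) p = refl
walk-cons m false (nd s b d) p = refl

Feasible : ℕ → NodeData → Set
Feasible ℓ x = (0ℚ < size x) × (size x * (pow2 (2 ^ℕ ℓ) - 1ℚ) ≤ budget x)

size≤budget : ∀ ℓ x → Feasible ℓ x → size x ≤ budget x
size≤budget ℓ (nd s b d) (0<s , feas) = begin
  s                          ≡⟨ sym (*-identityʳ s) ⟩
  s * 1ℚ                     ≤⟨ *-monoˡ-≤-0≤ (<⇒≤ 0<s) (+-monoˡ-≤ (- 1ℚ) (two≤pow2 ℓ)) ⟩
  s * (pow2 (2 ^ℕ ℓ) - 1ℚ)   ≤⟨ feas ⟩
  b                          ∎
  where open ≤-Reasoning

root-feasible : ∀ L → Feasible L (rootData L)
root-feasible L = pow2-pos L , (begin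
  P * (P - 1ℚ)             ≤⟨ x≤x+y (<⇒≤ (pow2-pos L)) ⟩
  P * (P - 1ℚ) + P         ≡⟨ solve 1 (λ P → P :* (P :- con 1ℚ) :+ P := P :* P) refl P ⟩
  P * P                    ≡⟨ sym (pow2-square L) ⟩
  pow2 (2 ^ℕ suc L)        ∎)
  where open ≤-Reasoning
        open +-*-Solver
        P = pow2 (2 ^ℕ L)

-- Right child: the spent size s·(Q − 2) ≥ 0 absorbs the loss of budget s.
feasible-right : ∀ m s b d → Feasible (suc m) (nd s b d) → Feasible m (child m true (nd s b d))
feasible-right m s b d (0<s , feas) = 0<* 0<s (pow2-pos m) , (begin
  s * Q * (Q - 1ℚ)                          ≤⟨ x≤x+y (0≤* (<⇒≤ 0<s) (0≤y-x (two≤pow2 m))) ⟩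
  s * Q * (Q - 1ℚ) + s * (Q - toℚ 2)        ≡⟨ solve 2 (λ s Q → s :* Q :* (Q :- con 1ℚ) :+ s :* (Q :- con (toℚ 2))
                                                              := s :* (Q :* Q :- con 1ℚ) :- s) refl s Q ⟩
  s * (Q * Q - 1ℚ) - s                      ≤⟨ +-monoˡ-≤ (- s) (subst (λ P → s * (P - 1ℚ) ≤ b) (pow2-square m) feas) ⟩
  b - s                                     ∎)
  where open ≤-Reasoning
        open +-*-Solver
        Q = pow2 (2 ^ℕ m)

-- Left child: the new budget s equals s·2^{-2^m}·2^{2^m}.
feasible-left : ∀ m s b d → Feasible (suc m) (nd s b d) → Feasible m (child m false (nd s b d))
feasible-left m s b d (0<s , _) = 0<sI , (begin
  s * I * (Q - 1ℚ)             ≤⟨ x≤x+y (<⇒≤ 0<sI) ⟩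
  s * I * (Q - 1ℚ) + s * I     ≡⟨ solve 3 (λ s I Q → s :* I :* (Q :- con 1ℚ) :+ s :* I := s :* (I :* Q)) refl s I Q ⟩
  s * (I * Q)                  ≡⟨ cong (s *_) (invPow2-pow2 (2 ^ℕ m)) ⟩
  s * 1ℚ                       ≡⟨ *-identityʳ s ⟩
  s                            ∎)
  where open ≤-Reasoning
        open +-*-Solver
        Q = pow2 (2 ^ℕ m)
        I = invPow2 (2 ^ℕ m)
        0<sI = 0<* 0<s (invPow2-pos (2 ^ℕ m))

feasible-child : ∀ m c x → Feasible (suc m) x → Feasible m (child m c x)
feasible-child m true  (nd s b d) = feasible-right m s b d
feasible-child m false (nd s b d) = feasible-left m s b d

-- Distance plus remaining budget: an upper bound for all distances below.
potential : NodeData → ℚ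
potential x = dist x + budget x

dist-child : ∀ m c x → Feasible (suc m) x → dist x ≤ dist (child m c x)
dist-child m true  (nd s b d) _ = ≤-refl
dist-child m false (nd s b d) f = x≤x+y (0≤y-x (size≤budget (suc m) (nd s b d) f))

potential-child : ∀ m c x → Feasible (suc m) x → potential (child m c x) ≤ potential x
potential-child m true (nd s b d) (0<s , _) = +-monoʳ-≤ d (begin
  b - s         ≤⟨ x≤x+y (<⇒≤ 0<s) ⟩
  b - s + s     ≡⟨ solve 2 (λ b s → b :- s :+ s := b) refl b s ⟩
  b             ∎)
  where open ≤-Reasoning
        open +-*-Solver
potential-child m false (nd s b d) _ =
  ≤-reflexive (solve 3 (λ d b s → d :+ (b :- s) :+ s := d :+ b) refl d b s)
  where open +-*-Solver

along-walk : (P : ℕ → NodeData → Set) → (∀ m c x → P (suc m) x → P m (child m c x)) →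
  ∀ ℓ x p → length p ℕ.≤ ℓ → P ℓ x → P (ℓ ∸ length p) (walk ℓ x p)
along-walk P step ℓ x [] _ px = px
along-walk P step (suc m) x (c ∷ p) (s≤s p≤m) px rewrite walk-cons m c x p =
  along-walk P step m (child m c x) p p≤m (step m c x px)

along-walk-rel : (R : NodeData → NodeData → Set) → Reflexive R → Transitive R →
  (∀ m c x → Feasible (suc m) x → R x (child m c x)) →
  ∀ ℓ x p → length p ℕ.≤ ℓ → Feasible ℓ x → R x (walk ℓ x p)
along-walk-rel R R-refl R-trans step ℓ x p p≤ℓ fx =
  proj₂ (along-walk (λ k y → Feasible k y × R x y) preserved ℓ x p p≤ℓ (fx , R-refl))
  where
  preserved : ∀ m c y → Feasible (suc m) y × R x y → Feasible m (child m c y) × R x (child m c y)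
  preserved m c y (fy , rxy) = feasible-child m c y fy , R-trans rxy (step m c y fy)

dist-walk : ∀ ℓ x p → length p ℕ.≤ ℓ → Feasible ℓ x → dist x ≤ dist (walk ℓ x p)
dist-walk = along-walk-rel (λ x y → dist x ≤ dist y) ≤-refl ≤-trans dist-child

potential-walk : ∀ ℓ x p → length p ℕ.≤ ℓ → Feasible ℓ x → potential (walk ℓ x p) ≤ potential x
potential-walk = along-walk-rel (λ x y → potential y ≤ potential x) ≤-refl (λ p q → ≤-trans q p) potential-child

dist<potential-walk : ∀ ℓ x p → length p ℕ.≤ ℓ → Feasible ℓ x → dist (walk ℓ x p) < potential (walk ℓ x p)
dist<potential-walk ℓ x p p≤ℓ fx with along-walk Feasible feasible-child ℓ x p p≤ℓ fx
... | fy@(0<s , _) = x<x+y (<-≤-trans 0<s (size≤budget (ℓ ∸ length p) (walk ℓ x p) fy))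

-- At a feasible node of level suc m, the right subtree lies strictly to the
-- left of the left subtree; the potential of the right child is the pivot.
separation-at : ∀ m x w w′ → Feasible (suc m) x → length w ℕ.≤ m → length w′ ℕ.≤ m →
  dist (walk (suc m) x (true ∷ w′)) < dist (walk (suc m) x (false ∷ w))
-- (x is split so that `walk` and `child` unfold definitionally.)
separation-at m x@(nd s b d) w w′ fx w≤m w′≤m = begin-strict
  dist (walk m xr w′)        <⟨ dist<potential-walk m xr w′ w′≤m (feasible-child m true x fx) ⟩
  potential (walk m xr w′)   ≤⟨ potential-walk m xr w′ w′≤m (feasible-child m true x fx) ⟩
  potential xr               ≡⟨⟩
  dist xl                    ≤⟨ dist-walk m xl w w≤m (feasible-child m false x fx) ⟩
  dist (walk m xl w)         ∎
  where open ≤-Reasoning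
        xr xl : NodeData
        xr = child m true x
        xl = child m false x

separation : ∀ ℓ x u w w′ → Feasible ℓ x →
  length (u ++ false ∷ w) ℕ.< ℓ → length (u ++ true ∷ w′) ℕ.< ℓ →
  dist (walk ℓ x (u ++ true ∷ w′)) < dist (walk ℓ x (u ++ false ∷ w))
separation (suc m) x [] w w′ fx (s≤s w<m) (s≤s w′<m) =
  separation-at m x w w′ fx (ℕ.<⇒≤ w<m) (ℕ.<⇒≤ w′<m)
separation (suc m) x (c ∷ u) w w′ fx (s≤s left<m) (s≤s right<m)
  rewrite walk-cons m c x (u ++ true ∷ w′) | walk-cons m c x (u ++ false ∷ w) =
  separation m (child m c x) u w w′ (feasible-child m c x fx) left<m right<m

-- The corollary: the separation at the (feasible) root.  The hypotheses
-- 2 ≤ L and length u + 2 ≤ L are implied by the two length bounds.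
corollary1 : (L : ℕ) → 2 ℕ.≤ L →
    (u : List Bool) → length u ℕ.+ 2 ℕ.≤ L →
    (w w′ : List Bool) →
    length (u ++ false ∷ w) ℕ.< L → length (u ++ true ∷ w′) ℕ.< L →
    dρ L (u ++ false ∷ w) >ℚ dρ L (u ++ true ∷ w′)
corollary1 L _ u _ w w′ left<L right<L =
  separation L (rootData L) u w w′ (root-feasible L) left<L right<L
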